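{- Let $g\ge1$ and $\kappa\ge1$ be integers, let $H$ be a graph, and let $A,B,X$ be disjoint subsets of $V(H)$ of cardinality $\kappa$ each, such that every vertex of $X$ has degree $1$ in $H$. Let $\mathcal{P}$ be a set of $\kappa$ node-disjoint paths connecting every vertex of $A$ to a distinct vertex of $B$, and $\mathcal{Q}$ a set of $\kappa$ node-disjoint paths connecting every vertex of $A$ to a distinct vertex of $X$, chosen among all such pairs $(\mathcal P,\mathcal Q)$ so as to minimize the number of edges of the graph $\bigcup_{P\in\mathcal P\cup\mathcal Q}P$ (assume at least one such pair exists). Let $D$ be any integer with $1\leq D\leq \kappa/(2g^2)$. Then either $H$ contains an $(A,B,X)$-crossbar of width $g^2$, or $H$ contains a pseudo-grid of depth $D$ with respect to $(\mathcal P,\mathcal Q)$.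
   Context: For $P\in\mathcal P$, $Q_P$ denotes the path of $\mathcal Q$ with the same endpoint in $A$ as $P$. A pseudo-grid of depth $D$ (with respect to $(\mathcal P,\mathcal Q)$) consists of: a family $\{\mathcal R_1,\ldots,\mathcal R_D\}$ of pairwise disjoint subsets of $\mathcal P$ with $|\mathcal R_i|\le g^2$ for all $i$; and, writing $\mathcal R=\bigcup_i\mathcal R_i$ and $\mathcal P'=\mathcal P\setminus\mathcal R$, a set $\mathcal Q'$ of $\lceil\kappa/4\rceil$ pairwise vertex-disjoint paths, each a sub-path of a distinct path of $\{Q_P\mid P\in\mathcal P'\}$ and having exactly one endpoint in $X$; such that (P1) the paths of $\mathcal P'$ are vertex-disjoint from the paths of $\mathcal Q'$, and (P2) for every $1\le i\le D$, at most $2g^2$ paths $Q\in\mathcal Q'$ are disjoint from all paths of $\mathcal R_i$. An $(A,B,X)$-crossbar of width $\rho$ consists of $\rho$ pairwise vertex-disjoint paths $\mathcal P^*$ each connecting a vertex of $A$ to a vertex of $B$, and for each $P\in\mathcal P^*$ a path $Q_P^*$ from a vertex of $P$ to a vertex of $X$, these paths pairwise vertex-disjoint, with $P\cap Q^*_{P'}=\emptyset$ for $P\ne P'$ and $P\cap Q^*_P$ a single vertex that is an endpoint of $Q^*_P$. -}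

module Defs where

open import Data.Nat using (ℕ; zero; suc; _+_; _*_; _≤_; _<ᵇ_; _^_; _/_)
open import Data.Bool using (Bool; true; false; _∧_; _∨_; if_then_else_)
open import Data.Fin using (Fin; toℕ)
open import Data.Fin.Properties using (_≟_)
open import Data.Fin.Subset using (Subset; _∈_; _∉_; ∣_∣)
open import Data.Vec using (tabulate)
open import Data.List using (List; []; _∷_; _++_; [_]; reverse; map; allFin)
open import Data.Nat.ListAction using (sum)
open import Data.Bool.ListAction using (any)
import Data.List as L
open import Data.List.Membership.Propositional renaming (_∈_ to _∈ₗ_)
open import Data.List.Relation.Unary.Unique.Propositional using (Unique)
open import Data.List.Relation.Unary.Linked using (Linked)
open import Data.Product using (Σ; ∃; ∃₂; _×_; _,_)
open import Data.Sum using (_⊎_)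
open import Data.Empty using (⊥)
open import Relation.Nullary using (¬_)
open import Relation.Nullary.Decidable using (⌊_⌋)
open import Relation.Binary.PropositionalEquality using (_≡_; _≢_)

record Graph (n : ℕ) : Set where
  field
    adj     : Fin n → Fin n → Bool
    adj-sym : ∀ u v → adj u v ≡ adj v u
    irrefl  : ∀ v → adj v v ≡ false
open Graph public

degree : ∀ {n} → Graph n → Fin n → ℕ
degree G x = ∣ tabulate (adj G x) ∣

DisjointSets : ∀ {n} → Subset n → Subset n → Set
DisjointSets S T = ∀ x → x ∈ S → x ∈ T → ⊥

IsPath : ∀ {n} → Graph n → List (Fin n) → Set
IsPath G p = (p ≢ []) × Unique p × Linked (λ u v → adj G u v ≡ true) p

StartsAt : ∀ {n} → List (Fin n) → Fin n → Set
StartsAt p a = ∃ λ rest → p ≡ a ∷ rest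

EndsAt : ∀ {n} → List (Fin n) → Fin n → Set
EndsAt p b = ∃ λ ini → p ≡ ini ++ [ b ]

Disjoint : ∀ {n} → List (Fin n) → List (Fin n) → Set
Disjoint p q = ∀ v → v ∈ₗ p → v ∈ₗ q → ⊥

SubPath : ∀ {n} → List (Fin n) → List (Fin n) → Set
SubPath q p = (q ≢ []) ×
  (∃₂ λ xs ys → (p ≡ xs ++ q ++ ys) ⊎ (p ≡ xs ++ reverse q ++ ys))

ExactlyOneEndIn : ∀ {n} → List (Fin n) → Subset n → Set
ExactlyOneEndIn p X = ∃₂ λ a b → StartsAt p a × EndsAt p b ×
  ((a ∈ X ⊎ b ∈ X) × (a ∈ X → b ∈ X → a ≡ b))

PairwiseDisjoint : ∀ {n k} → (Fin k → List (Fin n)) → Set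
PairwiseDisjoint {k = k} P = ∀ (i j : Fin k) → i ≢ j → Disjoint (P i) (P j)

-- k node-disjoint paths, each starting at a vertex of S and ending at a
-- vertex of T (with |S| = |T| = k these connect every vertex of S to a
-- distinct vertex of T)
Linkage : ∀ {n} → Graph n → Subset n → Subset n → (k : ℕ) →
          (Fin k → List (Fin n)) → Set
Linkage G S T k P =
  (∀ i → IsPath G (P i)) ×
  (∀ i → ∃₂ λ s t → s ∈ S × t ∈ T × StartsAt (P i) s × EndsAt (P i) t) ×
  PairwiseDisjoint P

consec : ∀ {n} → Fin n → Fin n → List (Fin n) → Bool
consec u v [] = false
consec u v (x ∷ []) = false
consec u v (x ∷ y ∷ r) =
  (⌊ x ≟ u ⌋ ∧ ⌊ y ≟ v ⌋) ∨ (⌊ x ≟ v ⌋ ∧ ⌊ y ≟ u ⌋) ∨ consec u v (y ∷ r)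

unionEdgeCount : ∀ {n} → List (List (Fin n)) → ℕ
unionEdgeCount {n} ps =
  sum (map (λ u → sum (map (λ v →
    if (toℕ u <ᵇ toℕ v) ∧ any (consec u v) ps then 1 else 0)
    (allFin n))) (allFin n))

edgesPQ : ∀ {n k} → (Fin k → List (Fin n)) → (Fin k → List (Fin n)) → ℕ
edgesPQ P Q = unionEdgeCount (L.tabulate P ++ L.tabulate Q)

record Crossbar {n} (G : Graph n) (A B X : Subset n) (ρ : ℕ) : Set where
  field
    Ps     : Fin ρ → List (Fin n)
    Qs     : Fin ρ → List (Fin n)
    Ps-ok  : Linkage G A B ρ Ps
    Qs-path : ∀ i → IsPath G (Qs i)
    Qs-ends : ∀ i → ∃₂ λ v x → v ∈ₗ Ps i × x ∈ X × StartsAt (Qs i) v × EndsAt (Qs i) x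
    Qs-disj : PairwiseDisjoint Qs
    cross-disj : ∀ i j → i ≢ j → Disjoint (Ps i) (Qs j)
    meet : ∀ i → ∃ λ v → v ∈ₗ Ps i × v ∈ₗ Qs i ×
             (∀ w → w ∈ₗ Ps i → w ∈ₗ Qs i → w ≡ v) ×
             (StartsAt (Qs i) v ⊎ EndsAt (Qs i) v)

-- Q is the path Q_P of 𝒬: same endpoint in A as P
SameAEnd : ∀ {n} → Subset n → List (Fin n) → List (Fin n) → Set
SameAEnd A P Q = ∃ λ a → a ∈ A × a ∈ₗ P × a ∈ₗ Q × (StartsAt P a ⊎ EndsAt P a)
                       × (StartsAt Q a ⊎ EndsAt Q a)

record PseudoGrid {n} (G : Graph n) (A X : Subset n) (g κ D : ℕ)
                  (P Q : Fin κ → List (Fin n)) : Set where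
  field
    R        : Fin D → Subset κ
    R-size   : ∀ i → ∣ R i ∣ ≤ g ^ 2
    R-disj   : ∀ i j → i ≢ j → ∀ k → k ∈ R i → k ∈ R j → ⊥
  -- 𝒫' = 𝒫 ∖ ⋃ R_i
  InR : Fin κ → Set
  InR k = ∃ λ i → k ∈ R i
  m : ℕ
  m = (κ + 3) / 4          -- ⌈κ/4⌉
  field
    Q'       : Fin m → List (Fin n)
    Q'-disj  : PairwiseDisjoint Q'
    -- Q'_j is a sub-path of Q_{P_{σ j}}, σ injective, P_{σ j} ∈ 𝒫'
    σ        : Fin m → Fin κ
    σ-inj    : ∀ j j' → σ j ≡ σ j' → j ≡ j'
    σ-out    : ∀ j → ¬ InR (σ j)
    Q'-sub   : ∀ j → ∃ λ l → SameAEnd A (P (σ j)) (Q l) × SubPath (Q' j) (Q l)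
    Q'-end   : ∀ j → ExactlyOneEndIn (Q' j) X
    P1       : ∀ k → ¬ InR k → ∀ j → Disjoint (P k) (Q' j)
    P2       : ∀ i (S : Subset m) →
               (∀ j → j ∈ S → ∀ k → k ∈ R i → Disjoint (Q' j) (P k)) →
               ∣ S ∣ ≤ 2 * g ^ 2

module Submission where

-- The sets R₁, R₂, … are chosen greedily.  Call a vertex free if it lies on a
-- path of 𝒫 that is not yet in any Rⱼ.  In each round every path of 𝒬 that still
-- has a free vertex is cut at its last free vertex h, and the new R collects the
-- paths of 𝒫 through these vertices.  The tail of such a path of 𝒬 from h onwards
-- meets no other free vertex, so if the new R has g² elements, these tails and
-- the corresponding paths of 𝒫 form a crossbar.  Otherwise R is recorded; later
-- rounds only cut before h, so every tail meets all earlier Rⱼ.  After D rounds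
-- at most Dg² ≤ κ/2 paths of 𝒫 are used; for ⌈κ/4⌉ of the others, the path of 𝒬
-- with the same end in A still has a free vertex, and its last tail is a path
-- of 𝒬′ that avoids 𝒫′ and meets every Rⱼ.

open import Defs
open import Data.Nat using (ℕ; zero; suc; _+_; _*_; _≤_; _∸_; _/_; _^_; z≤n; s≤s)
open import Data.Nat.Properties
  using ( module ≤-Reasoning; _≤?_; ≰⇒≥; <-irrefl; ≤-trans; ≤-reflexive; n≤1+n; m≤m+n; m<1+n⇒m≤n
        ; +-suc; +-comm; +-mono-≤; +-monoʳ-≤; +-monoˡ-≤; +-cancelʳ-≤; m∸n+n≡m; ∸-monoʳ-≤ )
open import Data.Nat.DivMod using (m<n*o⇒m/o<n)
open import Data.Nat.Tactic.RingSolver using (solve-∀)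
open import Data.Bool using (true)
open import Data.Bool.Properties using (T-≡)
open import Function.Bundles using (Equivalence)
open import Data.Fin using (Fin; zero; suc; inject≤; fromℕ<)
open import Data.Fin.Properties using (suc-injective; injective⇒≤; inject≤-injective; any?; _≟_)
open import Data.Fin.Subset using (Subset; _∈_; _∉_; ∣_∣; _∪_; ∁; ⁅_⁆; _⊆_; inside; outside) renaming (⊥ to ∅)
open import Data.Fin.Subset.Properties using (∣∁p∣≡n∸∣p∣; x∈∁p⇒x∉p; p⊆q⇒∣p∣≤∣q∣; x∈p∪q⁺; x∈p∪q⁻; _∈?_; ∣⊥∣≡0; ∉⊥; ∣⁅x⁆∣≡1; p⊂q⇒∣p∣<∣q∣; x∈⁅y⁆⇒x≡y; x≢y⇒x∉⁅y⁆)
open import Data.Vec using ([]; _∷_; here; there; tabulate)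
open import Data.Vec.Functional using (Vector) renaming (_∷_ to _∷ᵥ_)
open import Data.Vec.Properties using (lookup∘tabulate; []=⇒lookup; lookup⇒[]=)
open import Data.List using (List; []; _∷_; _++_; [_]; initLast; _∷ʳ′_)
open import Data.List.Properties using (∷-injectiveˡ; ++-assoc; ++-identityʳ; ∷ʳ-injectiveʳ)
open import Data.List.Relation.Unary.All using (All; []; _∷_)
import Data.List.Relation.Unary.All as All
open import Data.List.Relation.Unary.All.Properties using (++⁺)
open import Data.List.Relation.Unary.AllPairs using (AllPairs; _∷_)
open import Data.List.Relation.Unary.Linked using (Linked; []; _∷_)
open import Data.Product using (∃; ∃₂; _×_; _,_; proj₁; proj₂)
open import Data.List.Membership.Propositional using () renaming (_∈_ to _∈ₗ_)
open import Data.List.Relation.Unary.Any using (here; there)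
open import Data.List.Membership.Propositional.Properties using (∈-++⁺ʳ)
open import Data.Sum using (_⊎_; inj₁; inj₂; [_,_]′; map₂)
open import Data.Maybe using (Maybe; just; nothing)
open import Data.Maybe.Properties using (≡-dec; just-injective)
open import Data.Empty using (⊥; ⊥-elim)
open import Function.Definitions using (Injective)
open import Function using (_∘_; const; id)
open import Relation.Nullary using (¬_; ¬?; yes; no)
open import Relation.Nullary.Decidable using (⌊_⌋; fromWitness; toWitness; _×-dec_)
open import Relation.Unary using (Pred; Decidable)
open import Relation.Binary.PropositionalEquality hiding ([_])

-- Counting in finite subsets

∣p∪q∣≤∣p∣+∣q∣ : ∀ {n} (p q : Subset n) → ∣ p ∪ q ∣ ≤ ∣ p ∣ + ∣ q ∣
∣p∪q∣≤∣p∣+∣q∣ []            []            = z≤n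
∣p∪q∣≤∣p∣+∣q∣ (outside ∷ p) (outside ∷ q) = ∣p∪q∣≤∣p∣+∣q∣ p q
∣p∪q∣≤∣p∣+∣q∣ (outside ∷ p) (inside ∷ q)  =
  subst (suc ∣ p ∪ q ∣ ≤_) (sym (+-suc ∣ p ∣ ∣ q ∣)) (s≤s (∣p∪q∣≤∣p∣+∣q∣ p q))
∣p∪q∣≤∣p∣+∣q∣ (inside ∷ p)  (outside ∷ q) = s≤s (∣p∪q∣≤∣p∣+∣q∣ p q)
∣p∪q∣≤∣p∣+∣q∣ (inside ∷ p)  (inside ∷ q)  =
  s≤s (≤-trans (∣p∪q∣≤∣p∣+∣q∣ p q) (+-monoʳ-≤ ∣ p ∣ (n≤1+n ∣ q ∣)))

rank : ∀ {n} {p : Subset n} {x} → x ∈ p → Fin ∣ p ∣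
rank {p = inside ∷ p}  here        = zero
rank {p = inside ∷ p}  (there x∈p) = suc (rank x∈p)
rank {p = outside ∷ p} (there x∈p) = rank x∈p

rank-injective : ∀ {n} {p : Subset n} {x y} (x∈p : x ∈ p) (y∈p : y ∈ p) →
                 rank x∈p ≡ rank y∈p → x ≡ y
rank-injective {p = inside ∷ p}  here        here        _  = refl
rank-injective {p = inside ∷ p}  (there x∈p) (there y∈p) eq =
  cong suc (rank-injective x∈p y∈p (suc-injective eq))
rank-injective {p = outside ∷ p} (there x∈p) (there y∈p) eq =
  cong suc (rank-injective x∈p y∈p eq)

injection⇒≤∣p∣ : ∀ {n r} {p : Subset n} (f : Fin r → Fin n) →
                 Injective _≡_ _≡_ f → (∀ i → f i ∈ p) → r ≤ ∣ p ∣
injection⇒≤∣p∣ f f-inj f∈p =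
  injective⇒≤ (λ eq → f-inj (rank-injective (f∈p _) (f∈p _) eq))

select : ∀ {n} (p : Subset n) → Fin ∣ p ∣ → Fin n
select (inside ∷ p)  zero    = zero
select (inside ∷ p)  (suc i) = suc (select p i)
select (outside ∷ p) i       = suc (select p i)

select-∈ : ∀ {n} (p : Subset n) i → select p i ∈ p
select-∈ (inside ∷ p)  zero    = here
select-∈ (inside ∷ p)  (suc i) = there (select-∈ p i)
select-∈ (outside ∷ p) i       = there (select-∈ p i)

select-injective : ∀ {n} (p : Subset n) → Injective _≡_ _≡_ (select p)
select-injective (inside ∷ p)  {zero}  {zero}  _  = refl
select-injective (inside ∷ p)  {suc i} {suc j} eq = cong suc (select-injective p (suc-injective eq))
select-injective (outside ∷ p) eq = select-injective p (suc-injective eq)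

≤∣p∣⇒injection : ∀ {n r} (p : Subset n) → r ≤ ∣ p ∣ →
                 ∃ λ (f : Fin r → Fin n) → Injective _≡_ _≡_ f × (∀ i → f i ∈ p)
≤∣p∣⇒injection p r≤∣p∣ =
  (λ i → select p (inject≤ i r≤∣p∣)) ,
  (λ eq → inject≤-injective _ _ _ _ (select-injective p eq)) ,
  (λ i → select-∈ p _)

subsetOf : ∀ {n ℓ} {Pr : Pred (Fin n) ℓ} → Decidable Pr → Subset n
subsetOf Pr? = tabulate (λ x → ⌊ Pr? x ⌋)

∈-subsetOf⁺ : ∀ {n ℓ} {Pr : Pred (Fin n) ℓ} (Pr? : Decidable Pr) {x} → Pr x → x ∈ subsetOf Pr?
∈-subsetOf⁺ Pr? {x} px = lookup⇒[]= x _ (trans (lookup∘tabulate _ x) (Equivalence.to T-≡ (fromWitness px)))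

∈-subsetOf⁻ : ∀ {n ℓ} {Pr : Pred (Fin n) ℓ} (Pr? : Decidable Pr) {x} → x ∈ subsetOf Pr? → Pr x
∈-subsetOf⁻ Pr? {x} x∈ = toWitness (Equivalence.from T-≡ (trans (sym (lookup∘tabulate _ x)) ([]=⇒lookup x∈)))

-- Lists and paths

module _ {A : Set} where

  splitAtLast : ∀ {ℓ} {Pr : Pred A ℓ} → Decidable Pr → (xs : List A) →
    All (λ x → ¬ Pr x) xs ⊎
    ∃₂ λ pre h → ∃ λ post → xs ≡ pre ++ h ∷ post × Pr h × All (λ x → ¬ Pr x) post
  splitAtLast Pr? [] = inj₁ []
  splitAtLast Pr? (x ∷ xs) with splitAtLast Pr? xs | Pr? x
  ... | inj₂ (pre , h , post , eq , ph , ¬post) | _ = inj₂ (x ∷ pre , h , post , cong (x ∷_) eq , ph , ¬post)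
  ... | inj₁ ¬xs | yes px = inj₂ ([] , x , xs , refl , px , ¬xs)
  ... | inj₁ ¬xs | no ¬px = inj₁ (¬px ∷ ¬xs)

  AllPairs-++⁻ʳ : ∀ {ℓ} {R : A → A → Set ℓ} xs {ys} → AllPairs R (xs ++ ys) → AllPairs R ys
  AllPairs-++⁻ʳ []       rs       = rs
  AllPairs-++⁻ʳ (x ∷ xs) (_ ∷ rs) = AllPairs-++⁻ʳ xs rs

  Linked-++⁻ʳ : ∀ {ℓ} {R : A → A → Set ℓ} xs {ys} → Linked R (xs ++ ys) → Linked R ys
  Linked-++⁻ʳ []           rs              = rs
  Linked-++⁻ʳ (x ∷ [])     {[]}    _       = []
  Linked-++⁻ʳ (x ∷ [])     {_ ∷ _} (_ ∷ rs) = rs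
  Linked-++⁻ʳ (x ∷ y ∷ xs) (_ ∷ rs)        = Linked-++⁻ʳ (y ∷ xs) rs

EndsAt-++⁻ʳ : ∀ {n} xs {zs} {b : Fin n} → zs ≢ [] → EndsAt (xs ++ zs) b → EndsAt zs b
EndsAt-++⁻ʳ xs {zs} zs≢[] (ini , eq) with initLast zs
... | []         = ⊥-elim (zs≢[] refl)
... | ini′ ∷ʳ′ b′ = ini′ , cong (λ z → ini′ ++ [ z ])
  (∷ʳ-injectiveʳ (xs ++ ini′) ini (trans (++-assoc xs ini′ [ b′ ]) eq))

∈⇒≢[] : ∀ {A : Set} {v : A} {ys} → v ∈ₗ ys → ys ≢ []
∈⇒≢[] () refl

++-SubPath : ∀ {n} (pre ys : List (Fin n)) → ys ≢ [] → SubPath ys (pre ++ ys)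
++-SubPath pre ys ys≢[] = ys≢[] , pre , [] , inj₁ (cong (pre ++_) (sym (++-identityʳ ys)))

module _ {n} (G : Graph n) where

  IsPath-++⁻ʳ : ∀ xs {y ys} → IsPath G (xs ++ y ∷ ys) → IsPath G (y ∷ ys)
  IsPath-++⁻ʳ xs (_ , unique , linked) = (λ ()) , AllPairs-++⁻ʳ xs unique , Linked-++⁻ʳ xs linked

  two-neighbours⇒2≤degree : ∀ x {u w} → u ≢ w → adj G x u ≡ true → adj G x w ≡ true → 2 ≤ degree G x
  two-neighbours⇒2≤degree x {u} {w} u≢w xu xw =
    subst (λ k → suc k ≤ degree G x) (∣⁅x⁆∣≡1 u) (p⊂q⇒∣p∣<∣q∣ (⁅u⁆⊆N , w , w∈N , x≢y⇒x∉⁅y⁆ (u≢w ∘ sym)))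
    where
    ∈N : ∀ {v} → adj G x v ≡ true → v ∈ tabulate (adj G x)
    ∈N {v} xv = lookup⇒[]= v _ (trans (lookup∘tabulate _ v) xv)
    w∈N : w ∈ tabulate (adj G x)
    w∈N = ∈N xw
    ⁅u⁆⊆N : ⁅ u ⁆ ⊆ tabulate (adj G x)
    ⁅u⁆⊆N v∈ = ∈N (subst (λ v → adj G x v ≡ true) (sym (x∈⁅y⁆⇒x≡y u v∈)) xu)

  interior⇒2≤degree : ∀ u xs h r ys → IsPath G (u ∷ xs ++ h ∷ r ∷ ys) → 2 ≤ degree G h
  interior⇒2≤degree u []       h r ys (_ , (_ ∷ u≢r ∷ _) ∷ _ , uh ∷ hr ∷ _) =
    two-neighbours⇒2≤degree h u≢r (trans (adj-sym G h u) uh) hr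
  interior⇒2≤degree u (x ∷ xs) h r ys (_ , _ ∷ unique , _ ∷ linked) =
    interior⇒2≤degree x xs h r ys ((λ ()) , unique , linked)

  degree≡1⇒endpoint : ∀ xs h ys → IsPath G (xs ++ h ∷ ys) → degree G h ≡ 1 → xs ≡ [] ⊎ ys ≡ []
  degree≡1⇒endpoint []       h ys       _    _  = inj₁ refl
  degree≡1⇒endpoint (_ ∷ _)  h []       _    _  = inj₂ refl
  degree≡1⇒endpoint (u ∷ xs) h (r ∷ ys) path d≡1 =
    ⊥-elim (<-irrefl refl (subst (2 ≤_) d≡1 (interior⇒2≤degree u xs h r ys path)))

-- Linkages

module LinkageProperties {n k} {G : Graph n} {S T : Subset n} {P : Fin k → List (Fin n)}
                         (L : Linkage G S T k P) where

  path : ∀ i → IsPath G (P i)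
  path = proj₁ L

  ends : ∀ i → ∃₂ λ s t → s ∈ S × t ∈ T × StartsAt (P i) s × EndsAt (P i) t
  ends = proj₁ (proj₂ L)

  disjoint : PairwiseDisjoint P
  disjoint = proj₂ (proj₂ L)

  start end : Fin k → Fin n
  start i = let s , _ = ends i in s
  end   i = let _ , t , _ = ends i in t

  start∈S : ∀ i → start i ∈ S
  start∈S i = let _ , _ , s∈S , _ = ends i in s∈S

  end∈T : ∀ i → end i ∈ T
  end∈T i = let _ , _ , _ , t∈T , _ = ends i in t∈T

  startsAt : ∀ i → StartsAt (P i) (start i)
  startsAt i = let _ , _ , _ , _ , startsAt , _ = ends i in startsAt

  endsAt : ∀ i → EndsAt (P i) (end i)
  endsAt i = let _ , _ , _ , _ , _ , endsAt = ends i in endsAt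

  start∈path : ∀ i → start i ∈ₗ P i
  start∈path i with startsAt i
  ... | rest , eq = subst (start i ∈ₗ_) (sym eq) (here refl)

  shared⇒≡ : ∀ {i j v} → v ∈ₗ P i → v ∈ₗ P j → i ≡ j
  shared⇒≡ {i} {j} {v} v∈i v∈j with i ≟ j
  ... | yes i≡j = i≡j
  ... | no  i≢j = ⊥-elim (disjoint i j i≢j v v∈i v∈j)

  start-injective : Injective _≡_ _≡_ start
  start-injective {i} eq = shared⇒≡ (start∈path i) (subst (_∈ₗ P _) (sym eq) (start∈path _))

  starts-cover : ∣ S ∣ ≡ k → ∀ a → a ∈ S → ∃ λ i → start i ≡ a
  starts-cover ∣S∣≡k a a∈S with any? (λ i → start i ≟ a)
  ... | yes found = found
  ... | no  ¬found = ⊥-elim (<-irrefl (sym ∣S∣≡k) (injection⇒≤∣p∣ f f-injective f∈S))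
    where
    f : Fin (suc k) → Fin _
    f zero    = a
    f (suc i) = start i
    f-injective : Injective _≡_ _≡_ f
    f-injective {zero}  {zero}  _  = refl
    f-injective {zero}  {suc j} eq = ⊥-elim (¬found (j , sym eq))
    f-injective {suc i} {zero}  eq = ⊥-elim (¬found (i , eq))
    f-injective {suc i} {suc j} eq = cong suc (start-injective eq)
    f∈S : ∀ i → f i ∈ S
    f∈S zero    = a∈S
    f∈S (suc i) = start∈S i

module DegreeOneTargets {n k} {G : Graph n} {A X : Subset n} {Q : Fin k → List (Fin n)}
         (LQ : Linkage G A X k Q) (A∩X : DisjointSets A X)
         (degX : ∀ x → x ∈ X → degree G x ≡ 1) where

  open LinkageProperties {G = G} {A} {X} {Q} LQ

  ExactlyOneEndIn-suffix : ∀ l pre {ys} → Q l ≡ pre ++ ys → ys ≢ [] → ExactlyOneEndIn ys X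
  ExactlyOneEndIn-suffix l pre {[]}        _     []≢[] = ⊥-elim ([]≢[] refl)
  ExactlyOneEndIn-suffix l pre {h ∷ rest} split _     =
    h , end l , (rest , refl) ,
    EndsAt-++⁻ʳ pre (λ ()) (subst (λ p → EndsAt p (end l)) split (endsAt l)) ,
    inj₂ (end∈T l) , (λ h∈X _ → h≡end h∈X)
    where
    h≡end : h ∈ X → h ≡ end l
    h≡end h∈X with degree≡1⇒endpoint G pre h rest (subst (IsPath G) split (path l)) (degX h h∈X)
    ... | inj₁ refl = ⊥-elim (A∩X h (subst (_∈ A) start≡h (start∈S l)) h∈X)
      where
      start≡h : start l ≡ h
      start≡h = ∷-injectiveˡ (trans (sym (proj₂ (startsAt l))) split)
    ... | inj₂ refl = ∷ʳ-injectiveʳ pre (proj₁ (endsAt l)) (trans (sym split) (proj₂ (endsAt l)))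

-- The greedy rounds

module Rounds {n κ} {G : Graph n} {A B X : Subset n} {P Q : Fin κ → List (Fin n)}
              (LP : Linkage G A B κ P) (LQ : Linkage G A X κ Q) (w : ℕ) where

  open import Data.List.Membership.DecPropositional (_≟_ {n}) using () renaming (_∈?_ to _∈ₗ?_)

  module 𝒫 = LinkageProperties {G = G} {A} {B} {P} LP
  module 𝒬 = LinkageProperties {G = G} {A} {X} {Q} LQ

  Free : Subset κ → Fin n → Set
  Free S v = ∃ λ k → k ∉ S × v ∈ₗ P k

  free? : ∀ S → Decidable (Free S)
  free? S v = any? (λ k → ¬? (k ∈? S) ×-dec (v ∈ₗ? P k))

  Unfree : Subset κ → List (Fin n) → Set
  Unfree S = All (¬_ ∘ Free S)

  Unfree-mono : ∀ {S S′} → S ⊆ S′ → ∀ {ys} → Unfree S ys → Unfree S′ ys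
  Unfree-mono S⊆S′ = All.map (λ ¬free (k , k∉S′ , v∈P) → ¬free (k , k∉S′ ∘ S⊆S′ , v∈P))

  Meets : Subset κ → List (Fin n) → Set
  Meets T ys = ∃₂ λ v k → v ∈ₗ ys × k ∈ T × v ∈ₗ P k

  record Tail {i} (S : Subset κ) (R : Vector (Subset κ) i) (l : Fin κ) : Set where
    field
      pre tail : List (Fin n)
      split    : Q l ≡ pre ++ tail
      unfree   : Unfree S tail
      meets    : ∀ j → Meets (R j) tail

  record Stage (i : ℕ) : Set where
    field
      S          : Subset κ
      R          : Vector (Subset κ) i
      ∣S∣≤       : ∣ S ∣ ≤ i * w
      ∣R∣≤       : ∀ j → ∣ R j ∣ ≤ w
      R-disjoint : ∀ j j′ → j ≢ j′ → ∀ k → k ∈ R j → k ∈ R j′ → ⊥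
      R⊆S        : ∀ j {k} → k ∈ R j → k ∈ S
      S⊆⋃R       : ∀ {k} → k ∈ S → ∃ λ j → k ∈ R j
      tails      : ∀ l → Unfree S (Q l) ⊎ Tail S R l

  initial : Stage 0
  initial = record
    { S          = ∅
    ; R          = λ ()
    ; ∣S∣≤       = ≤-reflexive (∣⊥∣≡0 κ)
    ; ∣R∣≤       = λ ()
    ; R-disjoint = λ ()
    ; R⊆S        = λ ()
    ; S⊆⋃R       = λ k∈∅ → ⊥-elim (∉⊥ k∈∅)
    ; tails      = λ l → inj₂ (record
        { pre = Q l ; tail = [] ; split = sym (++-identityʳ (Q l)) ; unfree = [] ; meets = λ () })
    }

  module Round {i} (St : Stage i) where
    open Stage St

    record LastFree (l k : Fin κ) : Set where
      field
        pre rest : List (Fin n)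
        h        : Fin n
        split    : Q l ≡ pre ++ h ∷ rest
        k∉S      : k ∉ S
        h∈P      : h ∈ₗ P k
        unfree   : Unfree S rest
        meets    : ∀ j → Meets (R j) (h ∷ rest)

    lastFreeInTail : ∀ {l} → Tail S R l → Unfree S (Q l) ⊎ ∃ (LastFree l)
    lastFreeInTail {l} t with splitAtLast (free? S) (Tail.pre t)
    ... | inj₁ pre-unfree = inj₁ (subst (Unfree S) (sym (Tail.split t)) (++⁺ pre-unfree (Tail.unfree t)))
    ... | inj₂ (pre , h , mid , pre≡ , (k , k∉S , h∈P) , mid-unfree) = inj₂ (k , record
      { pre    = pre
      ; rest   = mid ++ Tail.tail t
      ; h      = h
      ; split  = trans (Tail.split t)
                   (trans (cong (_++ Tail.tail t) pre≡) (++-assoc pre (h ∷ mid) (Tail.tail t)))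
      ; k∉S    = k∉S
      ; h∈P    = h∈P
      ; unfree = ++⁺ mid-unfree (Tail.unfree t)
      ; meets  = λ j → meets-++ (Tail.meets t j)
      })
      where
      meets-++ : ∀ {T} → Meets T (Tail.tail t) → Meets T (h ∷ mid ++ Tail.tail t)
      meets-++ (v , k′ , v∈ , k′∈T , v∈P) = v , k′ , ∈-++⁺ʳ (h ∷ mid) v∈ , k′∈T , v∈P

    lastFree : ∀ l → Unfree S (Q l) ⊎ ∃ (LastFree l)
    lastFree l = [ inj₁ , lastFreeInTail ]′ (tails l)

    lastFreeIndex : Fin κ → Maybe (Fin κ)
    lastFreeIndex l = [ const nothing , just ∘ proj₁ ]′ (lastFree l)

    lastFreeIndex⇒LastFree : ∀ {l k} → lastFreeIndex l ≡ just k → LastFree l k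
    lastFreeIndex⇒LastFree {l} owns with lastFree l
    ... | inj₂ (k , lf) with refl ← owns = lf

    Rnew : Subset κ
    Rnew = subsetOf (λ k → any? (λ l → ≡-dec _≟_ (lastFreeIndex l) (just k)))

    Rnew⊆∁S : ∀ {k} → k ∈ Rnew → k ∉ S
    Rnew⊆∁S k∈ with ∈-subsetOf⁻ _ k∈
    ... | l , owns = LastFree.k∉S (lastFreeIndex⇒LastFree owns)

    module _ (k l : Fin w → Fin κ) (k-injective : Injective _≡_ _≡_ k)
             (owns : ∀ j → lastFreeIndex (l j) ≡ just (k j)) where

      private
        lf : ∀ j → LastFree (l j) (k j)
        lf j = lastFreeIndex⇒LastFree (owns j)
        open module LF j = LastFree (lf j)

      Qs : Fin w → List (Fin n)
      Qs j = h j ∷ rest j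

      Qs⊆Q : ∀ j {v} → v ∈ₗ Qs j → v ∈ₗ Q (l j)
      Qs⊆Q j v∈ = subst (_ ∈ₗ_) (sym (split j)) (∈-++⁺ʳ (pre j) v∈)

      P∩Qs⊆head : ∀ a b {v} → v ∈ₗ P (k a) → v ∈ₗ Qs b → v ≡ h b
      P∩Qs⊆head a b v∈P (here v≡h)   = v≡h
      P∩Qs⊆head a b v∈P (there v∈rs) = ⊥-elim (All.lookup (unfree b) v∈rs (k a , k∉S a , v∈P))

      l-injective : Injective _≡_ _≡_ l
      l-injective {a} {b} la≡lb =
        k-injective (just-injective (trans (sym (owns a)) (trans (cong lastFreeIndex la≡lb) (owns b))))

      crossbar : Crossbar G A B X w
      crossbar = record
        { Ps         = P ∘ k
        ; Qs         = Qs
        ; Ps-ok      = 𝒫.path ∘ k , 𝒫.ends ∘ k ,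
                       (λ a b a≢b → 𝒫.disjoint (k a) (k b) (a≢b ∘ k-injective))
        ; Qs-path    = λ j → IsPath-++⁻ʳ G (pre j) (subst (IsPath G) (split j) (𝒬.path (l j)))
        ; Qs-ends    = λ j → h j , 𝒬.end (l j) , h∈P j , 𝒬.end∈T (l j) , (rest j , refl) ,
                       EndsAt-++⁻ʳ (pre j) (λ ()) (subst (λ p → EndsAt p _) (split j) (𝒬.endsAt (l j)))
        ; Qs-disj    = λ a b a≢b v v∈a v∈b → a≢b (l-injective (𝒬.shared⇒≡ (Qs⊆Q a v∈a) (Qs⊆Q b v∈b)))
        ; cross-disj = λ a b a≢b v v∈P v∈Qs → a≢b (k-injective (𝒫.shared⇒≡ v∈P
                         (subst (_∈ₗ P (k b)) (sym (P∩Qs⊆head a b v∈P v∈Qs)) (h∈P b))))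
        ; meet       = λ j → h j , h∈P j , here refl , (λ v → P∩Qs⊆head j j) , inj₁ (rest j , refl)
        }

    crossbar-if-large : w ≤ ∣ Rnew ∣ → Crossbar G A B X w
    crossbar-if-large w≤ with ≤∣p∣⇒injection Rnew w≤
    ... | k , k-injective , k∈Rnew =
      crossbar k (λ j → proj₁ (lastFreeIndex-of j)) k-injective (λ j → proj₂ (lastFreeIndex-of j))
      where
      lastFreeIndex-of : ∀ j → ∃ λ l → lastFreeIndex l ≡ just (k j)
      lastFreeIndex-of j = ∈-subsetOf⁻ _ (k∈Rnew j)

    module _ (∣Rnew∣≤w : ∣ Rnew ∣ ≤ w) where

      private
        S′ : Subset κ
        S′ = S ∪ Rnew

        R′ : Vector (Subset κ) (suc i)
        R′ = Rnew ∷ᵥ R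

        S⊆S′ : S ⊆ S′
        S⊆S′ k∈S = x∈p∪q⁺ (inj₁ k∈S)

      LastFree⇒Tail : ∀ {l k} → LastFree l k → k ∈ Rnew → Tail S′ R′ l
      LastFree⇒Tail {l} {k} lf k∈Rnew = record
        { pre    = pre
        ; tail   = h ∷ rest
        ; split  = split
        ; unfree = h-unfree ∷ Unfree-mono S⊆S′ unfree
        ; meets  = λ { zero → h , k , here refl , k∈Rnew , h∈P ; (suc j) → meets j }
        }
        where
        open LastFree lf
        h-unfree : ¬ Free S′ h
        h-unfree (k′ , k′∉S′ , h∈P′) with 𝒫.shared⇒≡ h∈P h∈P′
        ... | refl = k′∉S′ (x∈p∪q⁺ (inj₂ k∈Rnew))

      next : Stage (suc i)
      next = record
        { S          = S′
        ; R          = R′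
        ; ∣S∣≤       = ≤-trans (∣p∪q∣≤∣p∣+∣q∣ S Rnew)
                         (≤-trans (+-mono-≤ ∣S∣≤ ∣Rnew∣≤w) (≤-reflexive (+-comm (i * w) w)))
        ; ∣R∣≤       = λ { zero → ∣Rnew∣≤w ; (suc j) → ∣R∣≤ j }
        ; R-disjoint = R′-disjoint
        ; R⊆S        = λ { zero k∈ → x∈p∪q⁺ (inj₂ k∈) ; (suc j) k∈ → S⊆S′ (R⊆S j k∈) }
        ; S⊆⋃R       = S′⊆⋃R′
        ; tails      = tails′
        }
        where
        R′-disjoint : ∀ j j′ → j ≢ j′ → ∀ k → k ∈ R′ j → k ∈ R′ j′ → ⊥
        R′-disjoint zero    zero     0≢0 _ _   _   = 0≢0 refl
        R′-disjoint zero    (suc j′) _   _ k∈  k∈′ = Rnew⊆∁S k∈ (R⊆S j′ k∈′)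
        R′-disjoint (suc j) zero     _   _ k∈  k∈′ = Rnew⊆∁S k∈′ (R⊆S j k∈)
        R′-disjoint (suc j) (suc j′) j≢j′ k k∈ k∈′ = R-disjoint j j′ (j≢j′ ∘ cong suc) k k∈ k∈′

        S′⊆⋃R′ : ∀ {k} → k ∈ S′ → ∃ λ j → k ∈ R′ j
        S′⊆⋃R′ {k} k∈S′ with x∈p∪q⁻ S Rnew k∈S′
        ... | inj₁ k∈S    = let j , k∈Rj = S⊆⋃R k∈S in suc j , k∈Rj
        ... | inj₂ k∈Rnew = zero , k∈Rnew

        tails′ : ∀ l → Unfree S′ (Q l) ⊎ Tail S′ R′ l
        tails′ l with lastFree l in eq
        ... | inj₁ unfree   = inj₁ (Unfree-mono S⊆S′ unfree)
        ... | inj₂ (k , lf) = inj₂ (LastFree⇒Tail lf (∈-subsetOf⁺ _ (l , cong [ const nothing , just ∘ proj₁ ]′ eq)))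

    round : Crossbar G A B X w ⊎ Stage (suc i)
    round with w ≤? ∣ Rnew ∣
    ... | yes w≤ = inj₁ (crossbar-if-large w≤)
    ... | no  w≰ = inj₂ (next (≰⇒≥ w≰))

  stage : ∀ i → Crossbar G A B X w ⊎ Stage i
  stage zero    = inj₂ initial
  stage (suc i) = [ inj₁ , Round.round ]′ (stage i)

-- The pseudo-grid

⌈m/4⌉≤m∸t : ∀ m t → t + t ≤ m → (m + 3) / 4 ≤ m ∸ t
⌈m/4⌉≤m∸t m t t+t≤m = m<1+n⇒m≤n (m<n*o⇒m/o<n (begin-strict
  m + 3         ≡⟨ cong (_+ 3) (sym (m∸n+n≡m t≤m)) ⟩
  u + t + 3     ≤⟨ +-monoˡ-≤ 3 (+-monoʳ-≤ u t≤u) ⟩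
  u + u + 3     <⟨ m≤m+n (suc (u + u + 3)) (u + u) ⟩
  suc (u + u + 3) + (u + u) ≡⟨ expand u ⟩
  suc u * 4     ∎))
  where
  open ≤-Reasoning
  u : ℕ
  u = m ∸ t
  t≤m : t ≤ m
  t≤m = ≤-trans (m≤m+n t t) t+t≤m
  t≤u : t ≤ u
  t≤u = +-cancelʳ-≤ t t u (subst (t + t ≤_) (sym (m∸n+n≡m t≤m)) t+t≤m)
  expand : ∀ u → suc (u + u + 3) + (u + u) ≡ suc u * 4
  expand = solve-∀

module _ {n κ} {G : Graph n} {A B X : Subset n} {P Q : Fin κ → List (Fin n)}
         (LP : Linkage G A B κ P) (LQ : Linkage G A X κ Q) (∣A∣≡κ : ∣ A ∣ ≡ κ)
         (A∩X : DisjointSets A X) (degX : ∀ x → x ∈ X → degree G x ≡ 1)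
         (g D : ℕ) (1≤D : 1 ≤ D) (D*2g²≤κ : D * (2 * g ^ 2) ≤ κ) where

  open Rounds {G = G} {A} {B} {X} {P} {Q} LP LQ (g ^ 2)
  open DegreeOneTargets {G = G} {A} {X} {Q} LQ A∩X degX using (ExactlyOneEndIn-suffix)

  m : ℕ
  m = (κ + 3) / 4

  pseudoGrid : Stage D → PseudoGrid G A X g κ D P Q
  pseudoGrid St = record
    { R        = R
    ; R-size   = ∣R∣≤
    ; R-disj   = R-disjoint
    ; Q'       = Q′
    ; Q'-disj  = Q′-disjoint
    ; σ        = σ
    ; σ-inj    = λ _ _ → σ-injective
    ; σ-out    = λ j (i , σj∈Ri) → σ∉S j (R⊆S i σj∈Ri)
    ; Q'-sub   = Q′-sub
    ; Q'-end   = λ j → ExactlyOneEndIn-suffix (l j) (Tail.pre (tailOf j)) (Tail.split (tailOf j)) (Q′≢[] j)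
    ; P1       = λ k k∉⋃R j v v∈P v∈Q′ →
                 All.lookup (Tail.unfree (tailOf j)) v∈Q′ (k , (λ k∈S → k∉⋃R (S⊆⋃R k∈S)) , v∈P)
    ; P2       = λ i T T-avoids-Ri → ≤-trans (p⊆q⇒∣p∣≤∣q∣ (avoiding-R⊆∅ i T T-avoids-Ri))
                                        (≤-trans (≤-reflexive (∣⊥∣≡0 m)) z≤n)
    }
    where
    open Stage St

    m≤∣∁S∣ : m ≤ ∣ ∁ S ∣
    m≤∣∁S∣ = begin
      m                 ≤⟨ ⌈m/4⌉≤m∸t κ (D * g ^ 2) (subst (_≤ κ) (double D (g ^ 2)) D*2g²≤κ) ⟩
      κ ∸ D * g ^ 2     ≤⟨ ∸-monoʳ-≤ κ ∣S∣≤ ⟩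
      κ ∸ ∣ S ∣         ≡⟨ ∣∁p∣≡n∸∣p∣ S ⟨
      ∣ ∁ S ∣           ∎
      where
      open ≤-Reasoning
      double : ∀ d x → d * (2 * x) ≡ d * x + d * x
      double = solve-∀

    chosen : ∃ λ (f : Fin m → Fin κ) → Injective _≡_ _≡_ f × (∀ j → f j ∈ ∁ S)
    chosen = ≤∣p∣⇒injection (∁ S) m≤∣∁S∣

    σ : Fin m → Fin κ
    σ = proj₁ chosen

    σ-injective : Injective _≡_ _≡_ σ
    σ-injective = proj₁ (proj₂ chosen)

    σ∉S : ∀ j → σ j ∉ S
    σ∉S j = x∈∁p⇒x∉p (proj₂ (proj₂ chosen) j)

    cover : ∀ j → ∃ λ l → 𝒬.start l ≡ 𝒫.start (σ j)
    cover j = 𝒬.starts-cover ∣A∣≡κ (𝒫.start (σ j)) (𝒫.start∈S (σ j))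

    l : Fin m → Fin κ
    l j = proj₁ (cover j)

    start∈Q : ∀ j → 𝒫.start (σ j) ∈ₗ Q (l j)
    start∈Q j = subst (_∈ₗ Q (l j)) (proj₂ (cover j)) (𝒬.start∈path (l j))

    tailOf : ∀ j → Tail S R (l j)
    tailOf j = [ (λ unfree → ⊥-elim (All.lookup unfree (start∈Q j) (σ j , σ∉S j , 𝒫.start∈path (σ j))))
               , id ]′ (tails (l j))

    Q′ : Fin m → List (Fin n)
    Q′ j = Tail.tail (tailOf j)

    Q′⊆Q : ∀ j {v} → v ∈ₗ Q′ j → v ∈ₗ Q (l j)
    Q′⊆Q j v∈ = subst (_ ∈ₗ_) (sym (Tail.split (tailOf j))) (∈-++⁺ʳ (Tail.pre (tailOf j)) v∈)

    Q′≢[] : ∀ j → Q′ j ≢ []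
    Q′≢[] j = let _ , _ , v∈Q′ , _ = Tail.meets (tailOf j) (fromℕ< 1≤D) in ∈⇒≢[] v∈Q′

    Q′-disjoint : PairwiseDisjoint Q′
    Q′-disjoint a b a≢b v v∈a v∈b = a≢b (σ-injective (𝒫.start-injective
      (trans (sym (proj₂ (cover a))) (trans (cong 𝒬.start la≡lb) (proj₂ (cover b))))))
      where
      la≡lb : l a ≡ l b
      la≡lb = 𝒬.shared⇒≡ (Q′⊆Q a v∈a) (Q′⊆Q b v∈b)

    avoiding-R⊆∅ : ∀ i (T : Subset m) →
                    (∀ j → j ∈ T → ∀ k → k ∈ R i → Disjoint (Q′ j) (P k)) → T ⊆ ∅
    avoiding-R⊆∅ i T T-avoids-Ri {j} j∈T =
      let v , k , v∈Q′ , k∈Ri , v∈P = Tail.meets (tailOf j) i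
      in ⊥-elim (T-avoids-Ri j j∈T k k∈Ri v v∈Q′ v∈P)

    Q′-sub : ∀ j → ∃ λ l′ → SameAEnd A (P (σ j)) (Q l′) × SubPath (Q′ j) (Q l′)
    Q′-sub j = l j ,
      (𝒫.start (σ j) , 𝒫.start∈S (σ j) , 𝒫.start∈path (σ j) , start∈Q j , inj₁ (𝒫.startsAt (σ j)) ,
       inj₁ (subst (StartsAt (Q (l j))) (proj₂ (cover j)) (𝒬.startsAt (l j)))) ,
      subst (SubPath (Q′ j)) (sym (Tail.split (tailOf j))) (++-SubPath _ (Q′ j) (Q′≢[] j))

theorem4p2 : ∀ {n} (g κ : ℕ) → 1 ≤ g → 1 ≤ κ →
    (G : Graph n) (A B X : Subset n) →
    ∣ A ∣ ≡ κ → ∣ B ∣ ≡ κ → ∣ X ∣ ≡ κ →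
    DisjointSets A B → DisjointSets A X → DisjointSets B X →
    (∀ x → x ∈ X → degree G x ≡ 1) →
    (P Q : Fin κ → List (Fin n)) →
    Linkage G A B κ P → Linkage G A X κ Q →
    (∀ (P′ Q′ : Fin κ → List (Fin n)) → Linkage G A B κ P′ → Linkage G A X κ Q′ →
       edgesPQ P Q ≤ edgesPQ P′ Q′) →
    (D : ℕ) → 1 ≤ D → D * (2 * g ^ 2) ≤ κ →
    Crossbar G A B X (g ^ 2) ⊎ PseudoGrid G A X g κ D P Q
theorem4p2 g κ _ _ G A B X ∣A∣≡κ _ _ _ A∩X _ degX P Q LP LQ _ D 1≤D D*2g²≤κ =
  map₂ (pseudoGrid {G = G} {A} {B} {X} {P} {Q} LP LQ ∣A∣≡κ A∩X degX g D 1≤D D*2g²≤κ)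
       (Rounds.stage {G = G} {A} {B} {X} {P} {Q} LP LQ (g ^ 2) D)
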